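{- If $H$ is an $i$-graph realizable graph with at least two vertices, then every induced subgraph of $H$ is $i$-graph realizable.
   Context: All graphs are finite and simple, with nonempty vertex sets. For a graph $G$, $i(G)$ denotes the minimum cardinality of an independent dominating set of $G$; an independent dominating set of cardinality $i(G)$ is an $i$-set of $G$. The $i$-graph $\mathcal{I}(G)$ of $G$ is the graph whose vertices are the $i$-sets of $G$, where two $i$-sets $S$ and $S'$ are adjacent if and only if there is an edge $xy\in E(G)$ with $S'=(S-\{x\})\cup\{y\}$. A graph $H$ is $i$-graph realizable (an $i$-graph) if there exists a graph $G$ with $\mathcal{I}(G)\cong H$. -}

module Defs where

open import Data.Nat using (ℕ; _≤_)
open import Data.Bool using (Bool; true; false)
open import Data.Fin using (Fin)
open import Data.Fin.Subset using (Subset; _∈_; _∪_; _-_; ⁅_⁆; ∣_∣)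
open import Data.Product using (Σ; ∃; ∃-syntax; _×_; _,_)
open import Data.Sum using (_⊎_)
open import Relation.Binary.PropositionalEquality using (_≡_; _≢_)
open import Function.Definitions using (Injective)
open import Function using (_⇔_)

record Graph : Set where
  field
    n        : ℕ
    nonempty : 1 ≤ n
    adj      : Fin n → Fin n → Bool
    adj-sym  : ∀ u v → adj u v ≡ adj v u
    adj-irr  : ∀ v → adj v v ≡ false

open Graph public

module _ (G : Graph) where

  Independent : Subset (n G) → Set
  Independent S = ∀ x y → x ∈ S → y ∈ S → adj G x y ≡ false

  Dominating : Subset (n G) → Set
  Dominating S = ∀ v → v ∈ S ⊎ (∃[ u ] (u ∈ S × adj G u v ≡ true))

  IndependentDominating : Subset (n G) → Set
  IndependentDominating S = Independent S × Dominating S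

  IsISet : Subset (n G) → Set
  IsISet S = IndependentDominating S
           × (∀ T → IndependentDominating T → ∣ S ∣ ≤ ∣ T ∣)

  -- adjacency in the i-graph: S ≠ S' (simple graph, no loops) and
  -- S' = (S - {x}) ∪ {y} for some edge xy of G.
  ISetAdj : Subset (n G) → Subset (n G) → Set
  ISetAdj S S' = S ≢ S'
               × (∃[ x ] ∃[ y ] (adj G x y ≡ true × S' ≡ (S - x) ∪ ⁅ y ⁆))

-- 𝓘(G) ≅ H : an injective enumeration f of the i-sets of G by the
-- vertices of H that is surjective onto i-sets and preserves and
-- reflects adjacency.
record IGraphIso (G H : Graph) : Set where
  field
    f        : Fin (n H) → Subset (n G)
    f-iset   : ∀ v → IsISet G (f v)
    f-inj    : Injective _≡_ _≡_ f
    f-surj   : ∀ S → IsISet G S → ∃[ v ] (f v ≡ S)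
    f-adj    : ∀ u v → (adj H u v ≡ true) ⇔ ISetAdj G (f u) (f v)

IGraphRealizable : Graph → Set
IGraphRealizable H = Σ Graph (λ G → IGraphIso G H)

induced : (H : Graph) (k : ℕ) → 1 ≤ k → (Fin k → Fin (n H)) → Graph
induced H k k≥1 e = record
  { n        = k
  ; nonempty = k≥1
  ; adj      = λ i j → adj H (e i) (e j)
  ; adj-sym  = λ i j → adj-sym H (e i) (e j)
  ; adj-irr  = λ i → adj-irr H (e i)
  }

{-# OPTIONS --safe #-}
module Submission where

-- Let φ : V(H) ≅ 𝓘(G), and let K₁, …, K_m be the i-sets φ(v) for the vertices v
-- outside the induced subgraph.  Add to G a clique of new vertices w₁, …, w_m and
-- join each w_j to every vertex of G outside K_j.  An independent dominating set
-- containing w_j must contain all of K_j (nothing else can dominate K_j), so it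
-- has more than i(G) vertices.  Hence, as long as some i-set S₀ of G survives,
-- i(G⁺) = i(G) and the i-sets of G⁺ are exactly the i-sets S ≠ K_j of G: such an
-- S dominates w_j because a dominating set inside the independent set K_j equals
-- K_j.  Token jumps between them are the jumps of G, so 𝓘(G⁺) is the induced
-- subgraph of 𝓘(G) on the surviving i-sets.

open import Defs
open import Data.Bool using (Bool; true; false; not)
open import Data.Nat using (ℕ; suc; _+_; _≤_; _<_)
open import Data.Nat.Properties using (≤-trans; <⇒≤; <⇒≱; m≤m+n; m<m+n; +-identityʳ; module ≤-Reasoning)
open import Data.Fin using (Fin; zero; suc; _↑ˡ_; _↑ʳ_; splitAt; _≟_)
open import Data.Fin.Properties using (splitAt-↑ˡ; splitAt-↑ʳ; any?)
open import Data.Fin.Subset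
open import Data.Fin.Subset.Properties
  using (⊆-antisym; ⊆-reflexive; Empty-unique; nonempty?; ∉⊥; ⊥⊆; ∣⊥∣≡0; p⊆q⇒∣p∣≤∣q∣; p⊂q⇒∣p∣<∣q∣;
         x∈⁅x⁆; x∈p∪q⁺; x∈p∧x≢y⇒x∈p-y; x∈p∩q⁺; x∈p∩q⁻; x∈∁p⇒x∉p; x∉∁p⇒x∈p; x∉p⇒x∈∁p;
         ∪-identityʳ; p─⊥≡p)
open import Data.Vec using (_∷_; []; _++_; here; there; lookup)
import Data.Vec as Vec
open import Data.Vec.Properties using ([]=⇒lookup; lookup⇒[]=; ++-injectiveˡ; zipWith-++)
import Data.List as List
open import Data.List.Relation.Unary.Any using (index)
open import Data.List.Relation.Unary.Any.Properties using (lookup-index)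
open import Data.List.Membership.Propositional.Properties using (∈-filter⁺; ∈-filter⁻; ∈-lookup; ∈-allFin)
open import Data.Product using (Σ-syntax; ∃-syntax; _×_; _,_; proj₁; proj₂; map₂)
open import Data.Sum using (inj₁; inj₂; _⊎_)
open import Data.Empty using (⊥-elim)
open import Relation.Nullary using (¬_; does; yes; no; ¬?; contradiction)
open import Relation.Nullary.Decidable using (dec-true)
open import Relation.Unary using (Pred; Decidable)
open import Relation.Binary.PropositionalEquality
open import Function using (_⇔_; mk⇔)
open import Function.Definitions using (Injective)
import Function.Properties.Equivalence as ⇔

enumerate : ∀ {n p} {P : Pred (Fin n) p} → Decidable P →
            ∃[ m ] Σ[ h ∈ (Fin m → Fin n) ] ((∀ j → P (h j)) × (∀ v → P v → ∃[ j ] h j ≡ v))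
enumerate {n} {P = P} P? = List.length xs , List.lookup xs , satisfies , onto
  where
  xs : List.List (Fin n)
  xs = List.filter P? (List.allFin n)
  satisfies : ∀ j → P (List.lookup xs j)
  satisfies j = proj₂ (∈-filter⁻ P? {xs = List.allFin n} (∈-lookup {xs = xs} j))
  onto : ∀ v → P v → ∃[ j ] List.lookup xs j ≡ v
  onto v Pv = index v∈xs , sym (lookup-index v∈xs)
    where v∈xs = ∈-filter⁺ P? (∈-allFin v) Pv

x∈p⇒0<∣p∣ : ∀ {n} {x : Fin n} {p : Subset n} → x ∈ p → 0 < ∣ p ∣
x∈p⇒0<∣p∣ {n} {x} {p} x∈p = subst (_< ∣ p ∣) (∣⊥∣≡0 n) (p⊂q⇒∣p∣<∣q∣ (⊥⊆ , x , x∈p , ∉⊥))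

p⊈q⇒∃∈p∉q : ∀ {n} {p q : Subset n} → p ⊈ q → ∃[ x ] (x ∈ p × x ∉ q)
p⊈q⇒∃∈p∉q {p = p} {q} p⊈q with nonempty? (p ∩ ∁ q)
... | yes (x , x∈p∩∁q) = x , map₂ x∈∁p⇒x∉p (x∈p∩q⁻ p (∁ q) x∈p∩∁q)
... | no p∩∁q-empty = ⊥-elim (p⊈q p⊆q)
  where
  p⊆q : p ⊆ q
  p⊆q {x} x∈p = x∉∁p⇒x∈p (λ x∈∁q → p∩∁q-empty (x , x∈p∩q⁺ (x∈p , x∈∁q)))

∣p++q∣≡∣p∣+∣q∣ : ∀ {a b} (p : Subset a) (q : Subset b) → ∣ p ++ q ∣ ≡ ∣ p ∣ + ∣ q ∣
∣p++q∣≡∣p∣+∣q∣ []          q = refl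
∣p++q∣≡∣p∣+∣q∣ (true ∷ p)  q = cong suc (∣p++q∣≡∣p∣+∣q∣ p q)
∣p++q∣≡∣p∣+∣q∣ (false ∷ p) q = ∣p++q∣≡∣p∣+∣q∣ p q

∣p∣≤∣p++q∣ : ∀ {a b} (p : Subset a) (q : Subset b) → ∣ p ∣ ≤ ∣ p ++ q ∣
∣p∣≤∣p++q∣ p q = subst (∣ p ∣ ≤_) (sym (∣p++q∣≡∣p∣+∣q∣ p q)) (m≤m+n ∣ p ∣ ∣ q ∣)

∣p++⊥∣≡∣p∣ : ∀ {a b} (p : Subset a) → ∣ p ++ ⊥ {b} ∣ ≡ ∣ p ∣
∣p++⊥∣≡∣p∣ {b = b} p = trans (∣p++q∣≡∣p∣+∣q∣ p ⊥) (trans (cong (∣ p ∣ +_) (∣⊥∣≡0 b)) (+-identityʳ ∣ p ∣))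

⊥++⊥ : ∀ a b → ⊥ {a} ++ ⊥ {b} ≡ ⊥
⊥++⊥ 0       b = refl
⊥++⊥ (suc a) b = cong (false ∷_) (⊥++⊥ a b)

⁅x↑ˡ⁆≡⁅x⁆++⊥ : ∀ {a} (x : Fin a) b → ⁅ x ↑ˡ b ⁆ ≡ ⁅ x ⁆ ++ ⊥
⁅x↑ˡ⁆≡⁅x⁆++⊥ {suc a} zero    b = cong (true ∷_) (sym (⊥++⊥ a b))
⁅x↑ˡ⁆≡⁅x⁆++⊥         (suc x) b = cong (false ∷_) (⁅x↑ˡ⁆≡⁅x⁆++⊥ x b)

↑ˡ∈-++⁺ : ∀ {a b} {x : Fin a} {p : Subset a} (q : Subset b) → x ∈ p → x ↑ˡ b ∈ p ++ q
↑ˡ∈-++⁺ q here        = here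
↑ˡ∈-++⁺ q (there x∈p) = there (↑ˡ∈-++⁺ q x∈p)

↑ˡ∈-++⁻ : ∀ {a b} {x : Fin a} (p : Subset a) {q : Subset b} → x ↑ˡ b ∈ p ++ q → x ∈ p
↑ˡ∈-++⁻ {x = zero}  (_ ∷ p) here      = here
↑ˡ∈-++⁻ {x = suc x} (_ ∷ p) (there h) = there (↑ˡ∈-++⁻ p h)

↑ʳ∈-++⁺ : ∀ {a b} {y : Fin b} (p : Subset a) {q : Subset b} → y ∈ q → a ↑ʳ y ∈ p ++ q
↑ʳ∈-++⁺ []      y∈q = y∈q
↑ʳ∈-++⁺ (_ ∷ p) y∈q = there (↑ʳ∈-++⁺ p y∈q)

↑ʳ∈-++⁻ : ∀ {a b} {y : Fin b} (p : Subset a) {q : Subset b} → a ↑ʳ y ∈ p ++ q → y ∈ q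
↑ʳ∈-++⁻ []      h         = h
↑ʳ∈-++⁻ (_ ∷ p) (there h) = ↑ʳ∈-++⁻ p h

↑ʳ∉-++⊥ : ∀ {a b} {y : Fin b} (p : Subset a) → a ↑ʳ y ∉ p ++ ⊥
↑ʳ∉-++⊥ p h = ∉⊥ (↑ʳ∈-++⁻ p h)

data Split (a b : ℕ) : Fin (a + b) → Set where
  left  : (x : Fin a) → Split a b (x ↑ˡ b)
  right : (y : Fin b) → Split a b (a ↑ʳ y)

split : ∀ a b (z : Fin (a + b)) → Split a b z
split 0       b y       = right y
split (suc a) b zero    = left zero
split (suc a) b (suc z) with split a b z
... | left x  = left (suc x)
... | right y = right y

independent⇒¬adj : ∀ G {S x y} → Independent G S → x ∈ S → y ∈ S → adj G x y ≢ true
independent⇒¬adj G indS x∈S y∈S x~y = contradiction (trans (sym (indS _ _ x∈S y∈S)) x~y) λ ()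

dominating⊆independent⇒≡ : ∀ G {D I} → Dominating G D → Independent G I → D ⊆ I → D ≡ I
dominating⊆independent⇒≡ G {D} {I} domD indI D⊆I = ⊆-antisym D⊆I I⊆D
  where
  I⊆D : I ⊆ D
  I⊆D {x} x∈I with domD x
  ... | inj₁ x∈D             = x∈D
  ... | inj₂ (u , u∈D , u~x) = ⊥-elim (independent⇒¬adj G indI (D⊆I u∈D) x∈I u~x)

module ExcludeISets (G : Graph) {m : ℕ} (K : Fin m → Subset (n G))
                    (K-ids : ∀ j → IndependentDominating G (K j))
                    (S₀ : Subset (n G)) (S₀-iset : IsISet G S₀) (S₀≢K : ∀ j → S₀ ≢ K j) where

  private
    N : ℕ
    N = n G

  -- inj₁ a is the vertex a of G, inj₂ j the new vertex w_j of the header.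
  adj⁺ : Fin N ⊎ Fin m → Fin N ⊎ Fin m → Bool
  adj⁺ (inj₁ a) (inj₁ b) = adj G a b
  adj⁺ (inj₁ a) (inj₂ j) = lookup (∁ (K j)) a
  adj⁺ (inj₂ j) (inj₁ a) = lookup (∁ (K j)) a
  adj⁺ (inj₂ i) (inj₂ j) = not (does (i ≟ j))

  adj⁺-sym : ∀ u v → adj⁺ u v ≡ adj⁺ v u
  adj⁺-sym (inj₁ a) (inj₁ b) = adj-sym G a b
  adj⁺-sym (inj₁ a) (inj₂ j) = refl
  adj⁺-sym (inj₂ j) (inj₁ a) = refl
  adj⁺-sym (inj₂ i) (inj₂ j) with i ≟ j | j ≟ i
  ... | yes _   | yes _   = refl
  ... | no  _   | no  _   = refl
  ... | yes i≡j | no  j≢i = contradiction (sym i≡j) j≢i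
  ... | no  i≢j | yes j≡i = contradiction (sym j≡i) i≢j

  adj⁺-irr : ∀ u → adj⁺ u u ≡ false
  adj⁺-irr (inj₁ a) = adj-irr G a
  adj⁺-irr (inj₂ j) = cong not (dec-true (j ≟ j) refl)

  G⁺ : Graph
  G⁺ = record
    { n        = N + m
    ; nonempty = ≤-trans (nonempty G) (m≤m+n N m)
    ; adj      = λ x y → adj⁺ (splitAt N x) (splitAt N y)
    ; adj-sym  = λ x y → adj⁺-sym (splitAt N x) (splitAt N y)
    ; adj-irr  = λ x → adj⁺-irr (splitAt N x)
    }

  old~old : ∀ a b → adj G⁺ (a ↑ˡ m) (b ↑ˡ m) ≡ adj G a b
  old~old a b rewrite splitAt-↑ˡ N a m | splitAt-↑ˡ N b m = refl

  old~new : ∀ a j → adj G⁺ (a ↑ˡ m) (N ↑ʳ j) ≡ lookup (∁ (K j)) a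
  old~new a j rewrite splitAt-↑ˡ N a m | splitAt-↑ʳ N m j = refl

  new~new : ∀ {i j} → i ≢ j → adj G⁺ (N ↑ʳ i) (N ↑ʳ j) ≡ true
  new~new {i} {j} i≢j rewrite splitAt-↑ʳ N m i | splitAt-↑ʳ N m j with i ≟ j
  ... | yes i≡j = contradiction i≡j i≢j
  ... | no  _   = refl

  ∉K⇒old~new : ∀ {a j} → a ∉ K j → adj G⁺ (a ↑ˡ m) (N ↑ʳ j) ≡ true
  ∉K⇒old~new {a} {j} a∉K = trans (old~new a j) ([]=⇒lookup (x∉p⇒x∈∁p a∉K))

  old~new⇒∉K : ∀ {a j} → adj G⁺ (a ↑ˡ m) (N ↑ʳ j) ≡ true → a ∉ K j
  old~new⇒∉K {a} {j} a~w = x∈∁p⇒x∉p (lookup⇒[]= a (∁ (K j)) (trans (sym (old~new a j)) a~w))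

  old≁new⇒∈K : ∀ {a j} → adj G⁺ (a ↑ˡ m) (N ↑ʳ j) ≡ false → a ∈ K j
  old≁new⇒∈K {a} {j} a≁w = x∉∁p⇒x∈p λ a∈∁K →
    contradiction (trans (sym (trans (old~new a j) ([]=⇒lookup a∈∁K))) a≁w) λ ()

  embed : Subset N → Subset (N + m)
  embed S = S ++ ⊥

  K⊆ : ∀ {T₁ T₂ j} → IndependentDominating G⁺ (T₁ ++ T₂) → j ∈ T₂ → K j ⊆ T₁
  K⊆ {T₁} {T₂} {j} (indT , domT) j∈T₂ {s} s∈K with domT (s ↑ˡ m)
  ... | inj₁ s∈T             = ↑ˡ∈-++⁻ T₁ s∈T
  ... | inj₂ (u , u∈T , u~s) = ⊥-elim (no-dominator (split N m u) u∈T u~s)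
    where
    w∈T : N ↑ʳ j ∈ T₁ ++ T₂
    w∈T = ↑ʳ∈-++⁺ T₁ j∈T₂
    no-dominator : ∀ {u} → Split N m u → u ∈ T₁ ++ T₂ → adj G⁺ u (s ↑ˡ m) ≢ true
    no-dominator (left b) b∈T b~s =
      independent⇒¬adj G (proj₁ (K-ids j)) (old≁new⇒∈K (indT _ _ b∈T w∈T)) s∈K
        (trans (sym (old~old b s)) b~s)
    no-dominator (right i) i∈T w~s with i ≟ j
    ... | yes refl = old~new⇒∉K (trans (adj-sym G⁺ _ _) w~s) s∈K
    ... | no  i≢j  = independent⇒¬adj G⁺ indT i∈T w∈T (new~new i≢j)

  restrict : ∀ {T₁ T₂} → Empty T₂ → IndependentDominating G⁺ (T₁ ++ T₂) → IndependentDominating G T₁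
  restrict {T₁} {T₂} T₂-empty (indT , domT) = indT₁ , domT₁
    where
    indT₁ : Independent G T₁
    indT₁ a b a∈T b∈T = trans (sym (old~old a b)) (indT _ _ (↑ˡ∈-++⁺ T₂ a∈T) (↑ˡ∈-++⁺ T₂ b∈T))
    old-dominator : ∀ {a u} → Split N m u → u ∈ T₁ ++ T₂ → adj G⁺ u (a ↑ˡ m) ≡ true →
                    ∃[ b ] (b ∈ T₁ × adj G b a ≡ true)
    old-dominator {a} (left b) b∈T b~a = b , ↑ˡ∈-++⁻ T₁ b∈T , trans (sym (old~old b a)) b~a
    old-dominator (right j) j∈T _ = ⊥-elim (T₂-empty (j , ↑ʳ∈-++⁻ T₁ j∈T))
    domT₁ : Dominating G T₁
    domT₁ a with domT (a ↑ˡ m)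
    ... | inj₁ a∈T             = inj₁ (↑ˡ∈-++⁻ T₁ a∈T)
    ... | inj₂ (u , u∈T , u~a) = inj₂ (old-dominator (split N m u) u∈T u~a)

  restrict-or-large : ∀ {T₁ T₂} → IndependentDominating G⁺ (T₁ ++ T₂) →
                      (Empty T₂ × IndependentDominating G T₁) ⊎ ∣ S₀ ∣ < ∣ T₁ ++ T₂ ∣
  restrict-or-large {T₁} {T₂} idsT with nonempty? T₂
  ... | no  T₂-empty     = inj₁ (T₂-empty , restrict T₂-empty idsT)
  ... | yes (j , j∈T₂) = inj₂ (begin-strict
    ∣ S₀ ∣           ≤⟨ proj₂ S₀-iset (K j) (K-ids j) ⟩
    ∣ K j ∣          ≤⟨ p⊆q⇒∣p∣≤∣q∣ (K⊆ idsT j∈T₂) ⟩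
    ∣ T₁ ∣           <⟨ m<m+n ∣ T₁ ∣ (x∈p⇒0<∣p∣ j∈T₂) ⟩
    ∣ T₁ ∣ + ∣ T₂ ∣  ≡⟨ ∣p++q∣≡∣p∣+∣q∣ T₁ T₂ ⟨
    ∣ T₁ ++ T₂ ∣     ∎)
    where open ≤-Reasoning

  S₀-minimal⁺ : ∀ T → IndependentDominating G⁺ T → ∣ S₀ ∣ ≤ ∣ T ∣
  S₀-minimal⁺ T idsT with Vec.splitAt N T
  ... | T₁ , T₂ , refl with restrict-or-large idsT
  ... | inj₁ (_ , idsT₁) = ≤-trans (proj₂ S₀-iset T₁ idsT₁) (∣p∣≤∣p++q∣ T₁ T₂)
  ... | inj₂ S₀<T        = <⇒≤ S₀<T

  ∣embed∣ : ∀ S → ∣ embed S ∣ ≡ ∣ S ∣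
  ∣embed∣ = ∣p++⊥∣≡∣p∣

  embed-ids : ∀ {S} → IndependentDominating G S → (∀ j → S ≢ K j) →
              IndependentDominating G⁺ (embed S)
  embed-ids {S} (indS , domS) S≢K = indS⁺ , domS⁺
    where
    S⊈K : ∀ j → S ⊈ K j
    S⊈K j S⊆K = S≢K j (dominating⊆independent⇒≡ G domS (proj₁ (K-ids j)) S⊆K)
    independent : ∀ {x y} → Split N m x → Split N m y → x ∈ embed S → y ∈ embed S →
                  adj G⁺ x y ≡ false
    independent (left a)  (left b)  a∈S b∈S =
      trans (old~old a b) (indS a b (↑ˡ∈-++⁻ S a∈S) (↑ˡ∈-++⁻ S b∈S))
    independent (left a)  (right j) _   j∈S = ⊥-elim (↑ʳ∉-++⊥ S j∈S)
    independent (right i) _         i∈S _   = ⊥-elim (↑ʳ∉-++⊥ S i∈S)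
    indS⁺ : Independent G⁺ (embed S)
    indS⁺ x y = independent (split N m x) (split N m y)
    dominated : ∀ {v} → Split N m v → v ∈ embed S ⊎ ∃[ u ] (u ∈ embed S × adj G⁺ u v ≡ true)
    dominated (left a) with domS a
    ... | inj₁ a∈S             = inj₁ (↑ˡ∈-++⁺ ⊥ a∈S)
    ... | inj₂ (u , u∈S , u~a) = inj₂ (u ↑ˡ m , ↑ˡ∈-++⁺ ⊥ u∈S , trans (old~old u a) u~a)
    dominated (right j) with p⊈q⇒∃∈p∉q (S⊈K j)
    ... | u , u∈S , u∉K = inj₂ (u ↑ˡ m , ↑ˡ∈-++⁺ ⊥ u∈S , ∉K⇒old~new u∉K)
    domS⁺ : Dominating G⁺ (embed S)
    domS⁺ v = dominated (split N m v)

  embed-iset : ∀ {S} → IsISet G S → (∀ j → S ≢ K j) → IsISet G⁺ (embed S)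
  embed-iset {S} (idsS , minS) S≢K = embed-ids idsS S≢K , λ T idsT → begin
    ∣ embed S ∣  ≡⟨ ∣embed∣ S ⟩
    ∣ S ∣        ≤⟨ minS S₀ (proj₁ S₀-iset) ⟩
    ∣ S₀ ∣       ≤⟨ S₀-minimal⁺ T idsT ⟩
    ∣ T ∣        ∎
    where open ≤-Reasoning

  S₀⁺-iset : IsISet G⁺ (embed S₀)
  S₀⁺-iset = embed-iset S₀-iset S₀≢K

  dominating-embed⇒⊈K : ∀ {S} → Dominating G⁺ (embed S) → ∀ j → S ⊈ K j
  dominating-embed⇒⊈K {S} domS j S⊆K with domS (N ↑ʳ j)
  ... | inj₁ w∈S             = ↑ʳ∉-++⊥ S w∈S
  ... | inj₂ (u , u∈S , u~w) = no-dominator (split N m u) u∈S u~w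
    where
    no-dominator : ∀ {u} → Split N m u → u ∈ embed S → adj G⁺ u (N ↑ʳ j) ≢ true
    no-dominator (left a)  a∈S a~w = old~new⇒∉K a~w (S⊆K (↑ˡ∈-++⁻ S a∈S))
    no-dominator (right i) i∈S _   = ↑ʳ∉-++⊥ S i∈S

  iset⁺⇒embed : ∀ T → IsISet G⁺ T → ∃[ S ] (IsISet G S × (∀ j → S ≢ K j) × T ≡ embed S)
  iset⁺⇒embed T (idsT , minT) with Vec.splitAt N T
  ... | T₁ , T₂ , refl with restrict-or-large idsT
  ... | inj₂ S₀<T = ⊥-elim (<⇒≱ (subst (_< ∣ T₁ ++ T₂ ∣) (sym (∣embed∣ S₀)) S₀<T)
                                (minT (embed S₀) (proj₁ S₀⁺-iset)))
  ... | inj₁ (T₂-empty , idsT₁) = T₁ , (idsT₁ , minT₁) , T₁≢K , T≡embed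
    where
    T≡embed : T₁ ++ T₂ ≡ embed T₁
    T≡embed = cong (T₁ ++_) (Empty-unique T₂-empty)
    minT₁ : ∀ U → IndependentDominating G U → ∣ T₁ ∣ ≤ ∣ U ∣
    minT₁ U idsU = begin
      ∣ T₁ ∣        ≤⟨ ∣p∣≤∣p++q∣ T₁ T₂ ⟩
      ∣ T₁ ++ T₂ ∣  ≤⟨ minT (embed S₀) (proj₁ S₀⁺-iset) ⟩
      ∣ embed S₀ ∣  ≡⟨ ∣embed∣ S₀ ⟩
      ∣ S₀ ∣        ≤⟨ proj₂ S₀-iset U idsU ⟩
      ∣ U ∣         ∎
      where open ≤-Reasoning
    T₁≢K : ∀ j → T₁ ≢ K j
    T₁≢K j T₁≡K = dominating-embed⇒⊈K (subst (Dominating G⁺) T≡embed (proj₂ idsT)) j (⊆-reflexive T₁≡K)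

  embed-jump : ∀ A x y → embed ((A - x) ∪ ⁅ y ⁆) ≡ (embed A - (x ↑ˡ m)) ∪ ⁅ y ↑ˡ m ⁆
  embed-jump A x y = sym (begin
    (embed A ─ ⁅ x ↑ˡ m ⁆) ∪ ⁅ y ↑ˡ m ⁆
      ≡⟨ cong₂ (λ p q → (embed A ─ p) ∪ q) (⁅x↑ˡ⁆≡⁅x⁆++⊥ x m) (⁅x↑ˡ⁆≡⁅x⁆++⊥ y m) ⟩
    ((A ++ ⊥) ─ (⁅ x ⁆ ++ ⊥)) ∪ (⁅ y ⁆ ++ ⊥)
      ≡⟨ cong (_∪ (⁅ y ⁆ ++ ⊥)) (zipWith-++ _ A ⊥ ⁅ x ⁆ ⊥) ⟩
    ((A - x) ++ (⊥ ─ ⊥)) ∪ (⁅ y ⁆ ++ ⊥)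
      ≡⟨ zipWith-++ _ (A - x) (⊥ ─ ⊥) ⁅ y ⁆ ⊥ ⟩
    ((A - x) ∪ ⁅ y ⁆) ++ ((⊥ ─ ⊥) ∪ ⊥)
      ≡⟨ cong ((A - x) ∪ ⁅ y ⁆ ++_) (trans (∪-identityʳ (⊥ ─ ⊥)) (p─⊥≡p ⊥)) ⟩
    embed ((A - x) ∪ ⁅ y ⁆) ∎)
    where open ≡-Reasoning

  embed-ISetAdj⁺ : ∀ {A B} → ISetAdj G A B → ISetAdj G⁺ (embed A) (embed B)
  embed-ISetAdj⁺ {A} (A≢B , x , y , x~y , B≡) =
    (λ eq → A≢B (++-injectiveˡ A _ eq)) , x ↑ˡ m , y ↑ˡ m ,
    trans (old~old x y) x~y , trans (cong embed B≡) (embed-jump A x y)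

  embed-ISetAdj⁻ : ∀ {A B} → Dominating G A → Independent G B →
                   ISetAdj G⁺ (embed A) (embed B) → ISetAdj G A B
  embed-ISetAdj⁻ {A} {B} domA indB (A⁺≢B⁺ , x , y , x~y , B⁺≡) =
    jump (split N m x) (split N m y) x~y B⁺≡
    where
    jump : ∀ {x y} → Split N m x → Split N m y → adj G⁺ x y ≡ true →
           embed B ≡ (embed A - x) ∪ ⁅ y ⁆ → ISetAdj G A B
    jump _ (right j) _ B⁺≡ = ⊥-elim (↑ʳ∉-++⊥ B (subst (N ↑ʳ j ∈_) (sym B⁺≡) (x∈p∪q⁺ (inj₂ (x∈⁅x⁆ _)))))
    jump (left a) (left b) a~b B⁺≡ =
      (λ A≡B → A⁺≢B⁺ (cong embed A≡B)) , a , b , trans (sym (old~old a b)) a~b ,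
      ++-injectiveˡ B _ (trans B⁺≡ (sym (embed-jump A a b)))
    -- A new vertex is never in embed A, so removing it changes nothing and A ⊆ B.
    jump (right j) (left b) _ B⁺≡ = ⊥-elim (A⁺≢B⁺ (cong embed (dominating⊆independent⇒≡ G domA indB A⊆B)))
      where
      A⊆B : A ⊆ B
      A⊆B {z} z∈A = ↑ˡ∈-++⁻ B (subst (z ↑ˡ m ∈_) (sym B⁺≡) (x∈p∪q⁺ (inj₁ (x∈p∧x≢y⇒x∈p-y z⁺∈A⁺ z⁺≢w))))
        where
        z⁺∈A⁺ : z ↑ˡ m ∈ embed A
        z⁺∈A⁺ = ↑ˡ∈-++⁺ ⊥ z∈A
        z⁺≢w : z ↑ˡ m ≢ N ↑ʳ j
        z⁺≢w z⁺≡w = ↑ʳ∉-++⊥ A (subst (_∈ embed A) z⁺≡w z⁺∈A⁺)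

  embed-ISetAdj : ∀ {A B} → IsISet G A → IsISet G B → ISetAdj G A B ⇔ ISetAdj G⁺ (embed A) (embed B)
  embed-ISetAdj ((_ , domA) , _) ((indB , _) , _) = mk⇔ embed-ISetAdj⁺ (embed-ISetAdj⁻ domA indB)

induced-realizable : ∀ {G H} → IGraphIso G H → ∀ {k} (k≥1 : 1 ≤ k) (e : Fin k → Fin (n H)) →
                     Injective _≡_ _≡_ e → ∀ {m} (h : Fin m → Fin (n H)) →
                     (∀ j → ¬ (∃[ i ] e i ≡ h j)) → (∀ v → ¬ (∃[ i ] e i ≡ v) → ∃[ j ] h j ≡ v) →
                     IGraphRealizable (induced H k k≥1 e)
induced-realizable {G} {H} φ {suc k} k≥1 e e-inj h h-outside h-onto = G⁺ , record
  { f      = λ i → embed (f (e i))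
  ; f-iset = λ i → embed-iset (f-iset (e i)) (survives i)
  ; f-inj  = λ eq → e-inj (f-inj (++-injectiveˡ _ _ eq))
  ; f-surj = onto
  ; f-adj  = λ u v → ⇔.trans (f-adj (e u) (e v)) (embed-ISetAdj (f-iset (e u)) (f-iset (e v)))
  }
  where
  open IGraphIso φ
  survives : ∀ i j → f (e i) ≢ f (h j)
  survives i j eq = h-outside j (i , f-inj eq)
  open ExcludeISets G (λ j → f (h j)) (λ j → proj₁ (f-iset (h j))) (f (e zero)) (f-iset (e zero)) (survives zero)
  onto : ∀ T → IsISet G⁺ T → ∃[ i ] embed (f (e i)) ≡ T
  onto T T-iset with iset⁺⇒embed T T-iset
  ... | S , S-iset , S≢K , T≡ with f-surj S S-iset
  ... | v , fv≡S with any? (λ i → e i ≟ v)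
  ... | yes (i , ei≡v) = i , trans (cong (λ w → embed (f w)) ei≡v) (trans (cong embed fv≡S) (sym T≡))
  ... | no  v-outside with h-onto v v-outside
  ...   | j , hj≡v = ⊥-elim (S≢K j (trans (sym fv≡S) (cong f (sym hj≡v))))

lemma5p2 : (H : Graph) → 2 ≤ n H → IGraphRealizable H →
           (k : ℕ) (k≥1 : 1 ≤ k) (e : Fin k → Fin (n H)) → Injective _≡_ _≡_ e →
           IGraphRealizable (induced H k k≥1 e)
lemma5p2 H _ (G , φ) k k≥1 e e-inj
  with enumerate (λ v → ¬? (any? (λ i → e i ≟ v)))
... | _ , h , h-outside , h-onto = induced-realizable φ k≥1 e e-inj h h-outside h-onto
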